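{- Let $y=\tan x$, $z=\sec x$, $D=d/dx$, and define $(Dy)^0(f)=f$, $(Dy)^{n+1}(f)=D\big(y\,(Dy)^n(f)\big)$. For $n\ge0$ write $$(Dy)^n(z)=\sum_{k=0}^{n}H(n,k)\,y^{2n-2k}z^{2k+1}.$$ Then for $0\le k\le n$, $H(n,k)=B(n,k)$, the Eulerian number of type $B$.
   Context: Let $B_n$ be the set of signed permutations of $\{\pm1,\dots,\pm n\}$ (bijections $\pi$ with $\pi(-i)=-\pi(i)$), and set $\pi(0)=0$. The type $B$ descent number is $\mathrm{des}_B(\pi)=|\{i\in\{0,1,\dots,n-1\}:\pi(i)>\pi(i+1)\}|$, and $B(n,k)$ is the number of $\pi\in B_n$ with $\mathrm{des}_B(\pi)=k$ (so $\sum_k B(n,k)x^k$ equals $1$, $1+x$, $1+6x+x^2$, $1+23x+23x^2+x^3$ for $n=0,1,2,3$). Equivalently $B(0,0)=1$, $B(0,k)=0$ for $k\ge1$, and $B(n+1,k)=(2k+1)B(n,k)+(2n-2k+3)B(n,k-1)$. -}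

module Defs where

open import Data.Nat using (ℕ; zero; suc; _+_; _*_; _∸_; _≡ᵇ_)
open import Data.Bool using (if_then_else_; _∧_)

-- Type B Eulerian numbers B(n,k), via the recurrence
--   B(0,0)=1, B(0,k)=0 (k≥1), B(n+1,k) = (2k+1)B(n,k) + (2n-2k+3)B(n,k-1)
-- (for k = 0 the second term is absent, B(n,-1) = 0).
eulerB : ℕ → ℕ → ℕ
eulerB zero    zero    = 1
eulerB zero    (suc k) = 0
eulerB (suc n) zero    = eulerB n zero
eulerB (suc n) (suc k) =
  (2 * suc k + 1) * eulerB n (suc k) + ((2 * n + 3) ∸ (2 * suc k)) * eulerB n k

-- Formal (power) series in two commuting variables y, z with ℕ coefficients:
-- p a b is the coefficient of y^a z^b.
Series : Set
Series = ℕ → ℕ → ℕ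

mono : ℕ → ℕ → Series
mono a b c d = if (a ≡ᵇ c) ∧ (b ≡ᵇ d) then 1 else 0

mulY : Series → Series
mulY p zero    d = 0
mulY p (suc c) d = p c d

-- The derivation D with D y = z² (= sec² x) and D z = y z (= sec x tan x):
-- D(y^a z^b) = a y^(a-1) z^(b+2) + b y^(a+1) z^b.
D : Series → Series
D p c d = termA d + termB c
  where
  termA : ℕ → ℕ
  termA (suc (suc d')) = suc c * p (suc c) d'
  termA _              = 0
  termB : ℕ → ℕ
  termB (suc c') = d * p c' d
  termB zero     = 0

DyPow : ℕ → Series → Series
DyPow zero    f = f
DyPow (suc n) f = D (mulY (DyPow n f))

zS : Series
zS = mono 0 1

sumTo : ℕ → (ℕ → ℕ) → ℕ
sumTo zero    f = f zero
sumTo (suc n) f = sumTo n f + f (suc n)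

expansion : (ℕ → ℕ → ℕ) → ℕ → Series
expansion H n c d = sumTo n (λ k → H n k * mono (2 * (n ∸ k)) (2 * k + 1) c d)

{-# OPTIONS --safe #-}
-- Since D (y · y^a z^b) = (a + 1) y^a z^(b+2) + b y^(a+2) z^b, each application of Dy
-- raises one of the two exponents by 2.  Starting from z, the series (Dy)^n z is therefore
-- supported on the monomials y^(2i) z^(2k+1) with i + k = n, and comparing coefficients
-- there gives H(n+1,k) = (2k+1) H(n,k) + (2i+1) H(n,k-1) with 2i + 1 = 2n - 2k + 3,
-- which is the recurrence of B(n,k).
module Submission where

open import Defs
open import Relation.Binary.PropositionalEquality
  using (_≡_; _≢_; refl; sym; trans; cong; cong₂; subst; subst₂; module ≡-Reasoning)
open import Data.Nat using (ℕ; zero; suc; _+_; _*_; _∸_; _≡ᵇ_; _≤_; _<_; z≤n; s≤s)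
open import Data.Nat.Properties
  using ( suc-injective; _≟_; ≡ᵇ⇒≡; ≤-refl; ≤-pred; ≤∧≢⇒<; <⇒≢; m<n⇒m<1+n; m≤n⇒m≤1+n; n<1+n
        ; m≤n+m; m+n∸n≡m; m∸n+n≡m; +-comm; +-suc; +-identityʳ; *-zeroʳ; *-identityʳ)
open import Data.Nat.Solver using (module +-*-Solver)
open import Data.Bool using (true; false; T; _∧_)
open import Data.Bool.Properties using (T-≡; T-∧)
open import Data.Product using (_×_; _,_)
open import Data.Empty using (⊥-elim)
open import Function using (_∘_)
open import Function.Bundles using (Equivalence)
open import Relation.Nullary using (¬_; Dec; yes; no)

open +-*-Solver using (solve; _:+_; _:*_; con; _:=_)
open ≡-Reasoning

double : ℕ → ℕ
double zero    = zero
double (suc n) = suc (suc (double n))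

2*n≡double : ∀ n → 2 * n ≡ double n
2*n≡double zero    = refl
2*n≡double (suc n) = cong suc (trans (+-suc n (n + 0)) (cong suc (2*n≡double n)))

2*n+1≡suc-double : ∀ n → 2 * n + 1 ≡ suc (double n)
2*n+1≡suc-double n = trans (+-comm (2 * n) 1) (cong suc (2*n≡double n))

double-injective : ∀ {m n} → double m ≡ double n → m ≡ n
double-injective {zero}  {zero}  _  = refl
double-injective {suc m} {suc n} eq = cong suc (double-injective (suc-injective (suc-injective eq)))

double≢suc-double : ∀ m n → double m ≢ suc (double n)
double≢suc-double (suc m) (suc n) eq = double≢suc-double m n (suc-injective (suc-injective eq))

data Parity : ℕ → Set where
  even : ∀ k → Parity (double k)
  odd  : ∀ k → Parity (suc (double k))

parity : ∀ n → Parity n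
parity zero = even zero
parity (suc n) with parity n
... | even k = odd k
... | odd k  = even (suc k)

sumTo-zero : ∀ m f → (∀ j → j ≤ m → f j ≡ 0) → sumTo m f ≡ 0
sumTo-zero zero    f vanish = vanish 0 z≤n
sumTo-zero (suc m) f vanish =
  cong₂ _+_ (sumTo-zero m f (λ j j≤m → vanish j (m≤n⇒m≤1+n j≤m))) (vanish (suc m) ≤-refl)

sumTo-single : ∀ m f {k} → k ≤ m → (∀ j → j ≢ k → f j ≡ 0) → sumTo m f ≡ f k
sumTo-single zero    f z≤n    others = refl
sumTo-single (suc m) f {k} k≤1+m others with k ≟ suc m
... | yes refl = cong (_+ f (suc m)) (sumTo-zero m f (λ j j≤m → others j (<⇒≢ (s≤s j≤m))))
... | no k≢1+m = begin
  sumTo m f + f (suc m) ≡⟨ cong₂ _+_ (sumTo-single m f (≤-pred (≤∧≢⇒< k≤1+m k≢1+m)) others)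
                                     (others (suc m) (k≢1+m ∘ sym)) ⟩
  f k + 0               ≡⟨ +-identityʳ (f k) ⟩
  f k                   ∎

mono-diag : ∀ a b → mono a b a b ≡ 1
mono-diag (suc a) b       = mono-diag a b
mono-diag zero    (suc b) = mono-diag zero b
mono-diag zero    zero    = refl

mono-off : ∀ a b c d → ¬ (a ≡ c × b ≡ d) → mono a b c d ≡ 0
mono-off a b c d off with (a ≡ᵇ c) ∧ (b ≡ᵇ d) in match
... | false = refl
... | true  = ⊥-elim (off (equalities (Equivalence.to T-∧ (Equivalence.from T-≡ match))))
  where
  equalities : T (a ≡ᵇ c) × T (b ≡ᵇ d) → a ≡ c × b ≡ d
  equalities (a≡c , b≡d) = ≡ᵇ⇒≡ a c a≡c , ≡ᵇ⇒≡ b d b≡d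

eulerB-vanishes : ∀ {n k} → n < k → eulerB n k ≡ 0
eulerB-vanishes {zero}  {suc k} _ = refl
eulerB-vanishes {suc n} {suc k} (s≤s n<k)
  rewrite eulerB-vanishes {n} {suc k} (m<n⇒m<1+n n<k) | eulerB-vanishes n<k =
  cong₂ _+_ (*-zeroʳ (2 * suc k + 1)) (*-zeroʳ (2 * n + 3 ∸ 2 * suc k))

-- The odd factors are written as suc (double _), the form in which D produces them.
eulerB-suc : ∀ {n} i k → i + k ≡ n →
  eulerB (suc n) (suc k) ≡ suc (double (suc k)) * eulerB n (suc k) + suc (double i) * eulerB n k
eulerB-suc i k refl =
  cong₂ (λ a b → a * eulerB (i + k) (suc k) + b * eulerB (i + k) k) (2*n+1≡suc-double (suc k)) factor
  where
  factor : 2 * (i + k) + 3 ∸ 2 * suc k ≡ suc (double i)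
  factor = begin
    2 * (i + k) + 3 ∸ 2 * suc k           ≡⟨ cong (_∸ 2 * suc k) regroup ⟩
    (2 * i + 1) + 2 * suc k ∸ 2 * suc k   ≡⟨ m+n∸n≡m (2 * i + 1) (2 * suc k) ⟩
    2 * i + 1                             ≡⟨ 2*n+1≡suc-double i ⟩
    suc (double i)                        ∎
    where
    regroup : 2 * (i + k) + 3 ≡ (2 * i + 1) + 2 * suc k
    regroup = solve 2 (λ i k → con 2 :* (i :+ k) :+ con 3
                             := (con 2 :* i :+ con 1) :+ con 2 :* (con 1 :+ k)) refl i k

data Support (n c d : ℕ) : Set where
  support : ∀ i k → i + k ≡ n → c ≡ double i → d ≡ suc (double k) → Support n c d

Support-raiseZ : ∀ {n c d} → Support n c d → Support (suc n) c (2 + d)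
Support-raiseZ (support i k eq refl refl) = support i (suc k) (trans (+-suc i k) (cong suc eq)) refl refl

Support-raiseY : ∀ {n c d} → Support n c d → Support (suc n) (2 + c) d
Support-raiseY (support i k eq refl refl) = support (suc i) k (cong suc eq) refl refl

support? : ∀ n c d → Dec (Support n c d)
support? n c d with parity c | parity d
... | odd i  | _      = no λ { (support _ _ _ c≡ _) → double≢suc-double _ i (sym c≡) }
... | even i | even k = no λ { (support _ _ _ _ d≡) → double≢suc-double k _ d≡ }
... | even i | odd k with i + k ≟ n
...   | yes eq  = yes (support i k eq refl refl)
...   | no i+k≢n = no λ { (support i′ k′ eq c≡ d≡) →
          i+k≢n (subst₂ (λ a b → a + b ≡ n) (double-injective (sym c≡))
                                              (double-injective (suc-injective (sym d≡))) eq) }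

SupportedOn : (ℕ → ℕ → Set) → Series → Set
SupportedOn S p = ∀ c d → ¬ S c d → p c d ≡ 0

D∘mulY-supportedOn : ∀ {S S′ : ℕ → ℕ → Set} {p} →
  (∀ {c d} → S c d → S′ c (2 + d)) → (∀ {c d} → S c d → S′ (2 + c) d) →
  SupportedOn S p → SupportedOn S′ (D (mulY p))
D∘mulY-supportedOn {S} {S′} {p} raiseZ raiseY supported = coefficient
  where
  lowerZ : ∀ {c d} → ¬ S′ c (2 + d) → p c d ≡ 0
  lowerZ off = supported _ _ (off ∘ raiseZ)
  lowerY : ∀ {c d} → ¬ S′ (2 + c) d → p c d ≡ 0
  lowerY off = supported _ _ (off ∘ raiseY)
  coefficient : SupportedOn S′ (D (mulY p))
  coefficient zero          zero          _   = refl
  coefficient zero          (suc zero)    _   = refl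
  coefficient zero          (suc (suc d)) off rewrite lowerZ off = refl
  coefficient (suc zero)    zero          _   = refl
  coefficient (suc zero)    (suc zero)    _   = refl
  coefficient (suc zero)    (suc (suc d)) off rewrite lowerZ off = *-zeroʳ (suc (suc d))
  coefficient (suc (suc c)) zero          _   = refl
  coefficient (suc (suc c)) (suc zero)    off rewrite lowerY off = refl
  coefficient (suc (suc c)) (suc (suc d)) off rewrite lowerZ off | lowerY off =
    cong₂ _+_ (*-zeroʳ (suc (suc (suc c)))) (*-zeroʳ (suc (suc d)))

DyPow-supportedOn : ∀ n → SupportedOn (Support n) (DyPow n zS)
DyPow-supportedOn zero    c d off = mono-off 0 1 c d λ { (refl , refl) → off (support 0 0 refl refl refl) }
DyPow-supportedOn (suc n) = D∘mulY-supportedOn Support-raiseZ Support-raiseY (DyPow-supportedOn n)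

expansion-supportedOn : ∀ H n → SupportedOn (Support n) (expansion H n)
expansion-supportedOn H n c d off = sumTo-zero n _ term-vanishes
  where
  term-vanishes : ∀ j → j ≤ n → H n j * mono (2 * (n ∸ j)) (2 * j + 1) c d ≡ 0
  term-vanishes j j≤n = trans (cong (H n j *_) (mono-off _ _ c d λ { (c≡ , d≡) →
    off (support (n ∸ j) j (m∸n+n≡m j≤n) (trans (sym c≡) (2*n≡double (n ∸ j)))
                                          (trans (sym d≡) (2*n+1≡suc-double j))) }))
    (*-zeroʳ (H n j))

DyPow-onSupport : ∀ {n} i k → i + k ≡ n → DyPow n zS (double i) (suc (double k)) ≡ eulerB n k
DyPow-onSupport zero    zero    refl = refl
DyPow-onSupport (suc i) zero    refl = trans (+-identityʳ _) (DyPow-onSupport i zero refl)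
DyPow-onSupport zero    (suc k) refl = begin
  1 * DyPow k zS 0 (suc (double k)) + 0                    ≡⟨ +-identityʳ _ ⟩
  1 * DyPow k zS 0 (suc (double k))                        ≡⟨ cong (1 *_) (DyPow-onSupport zero k refl) ⟩
  1 * eulerB k k                                           ≡˘⟨ cong (_+ 1 * eulerB k k) above-diagonal ⟩
  suc (double (suc k)) * eulerB k (suc k) + 1 * eulerB k k ≡˘⟨ eulerB-suc zero k refl ⟩
  eulerB (suc k) (suc k)                                   ∎
  where
  above-diagonal : suc (double (suc k)) * eulerB k (suc k) ≡ 0
  above-diagonal = trans (cong (suc (double (suc k)) *_) (eulerB-vanishes (n<1+n k)))
                         (*-zeroʳ (suc (double (suc k))))
DyPow-onSupport (suc i) (suc k) refl = begin
  suc (double (suc i)) * Q (double (suc i)) (suc (double k))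
    + suc (double (suc k)) * Q (double i) (suc (double (suc k)))
      ≡⟨ cong₂ (λ a b → suc (double (suc i)) * a + suc (double (suc k)) * b)
               (DyPow-onSupport (suc i) k (sym (+-suc i k))) (DyPow-onSupport i (suc k) refl) ⟩
  suc (double (suc i)) * eulerB n k + suc (double (suc k)) * eulerB n (suc k)
      ≡⟨ +-comm (suc (double (suc i)) * eulerB n k) _ ⟩
  suc (double (suc k)) * eulerB n (suc k) + suc (double (suc i)) * eulerB n k
      ≡˘⟨ eulerB-suc (suc i) k (sym (+-suc i k)) ⟩
  eulerB (suc n) (suc k) ∎
  where
  n : ℕ
  n = i + suc k
  Q : Series
  Q = DyPow n zS

expansion-onSupport : ∀ H {n} i k → i + k ≡ n → expansion H n (double i) (suc (double k)) ≡ H n k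
expansion-onSupport H {n} i k i+k≡n = begin
  sumTo n term ≡⟨ sumTo-single n term k≤n others ⟩
  term k       ≡⟨ cong (H n k *_) diagonal ⟩
  H n k * 1    ≡⟨ *-identityʳ (H n k) ⟩
  H n k        ∎
  where
  term : ℕ → ℕ
  term j = H n j * mono (2 * (n ∸ j)) (2 * j + 1) (double i) (suc (double k))
  k≤n : k ≤ n
  k≤n = subst (k ≤_) i+k≡n (m≤n+m k i)
  n∸k≡i : n ∸ k ≡ i
  n∸k≡i = trans (cong (_∸ k) (sym i+k≡n)) (m+n∸n≡m i k)
  diagonal : mono (2 * (n ∸ k)) (2 * k + 1) (double i) (suc (double k)) ≡ 1
  diagonal = trans (cong₂ (λ a b → mono a b (double i) (suc (double k)))
                          (trans (2*n≡double (n ∸ k)) (cong double n∸k≡i)) (2*n+1≡suc-double k))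
                   (mono-diag (double i) (suc (double k)))
  others : ∀ j → j ≢ k → term j ≡ 0
  others j j≢k = trans (cong (H n j *_) (mono-off (2 * (n ∸ j)) (2 * j + 1) (double i) (suc (double k))
    λ { (_ , d≡) → j≢k (double-injective (suc-injective (trans (sym (2*n+1≡suc-double j)) d≡))) }))
    (*-zeroʳ (H n j))

mainTheorem6 : ∀ (n c d : ℕ) → DyPow n zS c d ≡ expansion eulerB n c d
mainTheorem6 n c d with support? n c d
... | yes (support i k i+k≡n refl refl) =
  trans (DyPow-onSupport i k i+k≡n) (sym (expansion-onSupport eulerB i k i+k≡n))
... | no off =
  trans (DyPow-supportedOn n c d off) (sym (expansion-supportedOn eulerB n c d off))
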